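{- For every integer $k\geq 3$ there exists a graph $R_n$ on $n = k^2-1$ vertices with minimum degree $\delta(R_n) = \frac{n-k+1}{k}$ and $k-1$ cut edges.
   Context: All graphs are finite, simple and undirected; a cut edge is an edge whose removal disconnects the graph. -}

module Defs where

open import Data.Nat using (ℕ; _≤_)
open import Data.Fin using (Fin; _<_)
open import Data.Fin.Properties using (_≟_)
open import Data.Bool using (Bool; true; false; _∧_; not)
open import Data.List using (List; length; filterᵇ; allFin)
open import Data.Product using (Σ; ∃; _×_; _,_)
open import Relation.Binary.PropositionalEquality using (_≡_)
open import Relation.Nullary using (¬_)
open import Relation.Nullary.Decidable using (⌊_⌋)
open import Relation.Binary.Construct.Closure.ReflexiveTransitive using (Star)

record Graph (n : ℕ) : Set where
  field
    adj   : Fin n → Fin n → Bool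
    sym   : ∀ u v → adj u v ≡ adj v u
    irref : ∀ v → adj v v ≡ false
open Graph public

Adj : ∀ {n} → Graph n → Fin n → Fin n → Set
Adj G u v = adj G u v ≡ true

degree : ∀ {n} → Graph n → Fin n → ℕ
degree {n} G v = length (filterᵇ (adj G v) (allFin n))

MinDegree : ∀ {n} → Graph n → ℕ → Set
MinDegree G d = (∀ v → d ≤ degree G v) × (∃ λ v → degree G v ≡ d)

Reachable : ∀ {n} → Graph n → Fin n → Fin n → Set
Reachable G = Star (Adj G)

Connected : ∀ {n} → Graph n → Set
Connected G = ∀ u v → Reachable G u v

isEnd : ∀ {n} → Fin n → Fin n → Fin n → Fin n → Bool
isEnd a b u v = (⌊ u ≟ a ⌋ ∧ ⌊ v ≟ b ⌋)

deleteEdge : ∀ {n} → Graph n → Fin n → Fin n → Graph n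
deleteEdge G a b = record
  { adj   = λ u v → adj G u v ∧ not (isEnd a b u v) ∧ not (isEnd a b v u)
  ; sym   = symP
  ; irref = irrP
  }
  where
  open import Data.Bool.Properties using (∧-comm; ∧-assoc)
  open import Relation.Binary.PropositionalEquality using (cong₂; cong; trans)
  symP : ∀ u v → (adj G u v ∧ not (isEnd a b u v) ∧ not (isEnd a b v u))
               ≡ (adj G v u ∧ not (isEnd a b v u) ∧ not (isEnd a b u v))
  symP u v = cong₂ _∧_ (Graph.sym G u v) (∧-comm (not (isEnd a b u v)) (not (isEnd a b v u)))
  irrP : ∀ v → (adj G v v ∧ not (isEnd a b v v) ∧ not (isEnd a b v v)) ≡ false
  irrP v = cong (_∧ (not (isEnd a b v v) ∧ not (isEnd a b v v))) (irref G v)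

IsCutEdge : ∀ {n} → Graph n → Fin n → Fin n → Set
IsCutEdge G u v = Adj G u v × ¬ Connected (deleteEdge G u v)

-- G has exactly m cut edges: there is a duplicate-free list of exactly m
-- pairs (u , v) with u < v enumerating precisely the cut edges {u,v} of G
-- (each unordered edge recorded once, via u < v).
open import Data.List.Membership.Propositional using (_∈_)
open import Data.List.Relation.Unary.Unique.Propositional using (Unique)
open import Function.Bundles using (_⇔_)

NumCutEdges : ∀ {n} → Graph n → ℕ → Set
NumCutEdges {n} G m =
  Σ (List (Fin n × Fin n)) λ es →
    Unique es × length es ≡ m ×
    (∀ u v → ((u , v) ∈ es) ⇔ (u < v × IsCutEdge G u v))

module Submission where

-- The graph R_n (n = k² - 1, k ≥ 3) has a hub vertex joined to k - 1 "roots";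
-- each root heads its own block, a clique, and the blocks partition the
-- remaining vertices: k - 2 blocks of k + 1 vertices and one of k.  Hence
--   * R_n is connected (every vertex reaches the hub through its root);
--   * δ(R_n) = k - 1: the hub has exactly the k - 1 roots as neighbours, and
--     every other vertex is adjacent to the rest of its block (≥ k vertices);
--   * the cut edges are exactly the k - 1 hub–root edges: deleting one leaves
--     the root's block closed under adjacency, while any other edge lies
--     inside a block of size ≥ 3 and hence on a triangle.

open import Defs hiding (sym)
open import Data.Nat using (ℕ; zero; suc; _+_; _*_; _∸_; _/_; _≤_; _<_; z≤n; s≤s; NonZero; >-nonZero; _<?_; pred)
  renaming (_≟_ to _≟ℕ_)
open import Data.Nat.Properties
  using (≤-trans; ≤-reflexive; ≤-pred; ≤-antisym; <⇒≤; <⇒≢; <⇒≱; ≮⇒≥; +-comm; +-cancelˡ-≡; m≤m+n;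
         m∸n≤m; m+n∸n≡m; m+[n∸m]≡n; *-identityˡ; *-monoˡ-≤; +-mono-≤-<; +-identityʳ; ∸-monoˡ-≤)
open import Data.Nat.DivMod using (+-distrib-/-∣ˡ; m*n/n≡m; m<n⇒m/n≡0; m≥n⇒m/n>0; m<n*o⇒m/o<n)
open import Data.Nat.Divisibility using (divides-refl)
open import Data.Bool using (true; false; _∧_; not)
open import Data.Bool.Properties using (T-≡; ∧-zeroʳ)
open import Data.Empty using (⊥)
open import Data.Fin using (Fin; toℕ; fromℕ<) renaming (_<_ to _<ᶠ_)
open import Data.Fin.Properties using (_≟_; toℕ-injective; toℕ-fromℕ<; toℕ<n)
open import Data.List using (List; []; _∷_; length; map; filter; filterᵇ; allFin; applyUpTo; upTo)
open import Data.List.Properties using (filter-notAll; length-map; length-applyUpTo; length-upTo)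
open import Data.List.Relation.Unary.Any using (Any; here; there; any?)
import Data.List.Relation.Unary.Any as Any
import Data.List.Relation.Unary.All as All
open import Data.List.Relation.Unary.AllPairs using (_∷_)
open import Data.List.Membership.Propositional using (_∈_; find; lose)
open import Data.List.Membership.Propositional.Properties
  using (∈-filter⁺; ∈-filter⁻; ∈-allFin; ∈-map⁺; ∈-map⁻; ∈-applyUpTo⁻; ∈-upTo⁺; ∈-upTo⁻)
open import Data.List.Relation.Binary.Subset.Propositional using (_⊆_)
open import Data.List.Relation.Unary.Unique.Propositional using (Unique)
open import Data.List.Relation.Unary.Unique.Propositional.Properties
  using (map⁺; filter⁺; allFin⁺; applyUpTo⁺₁; upTo⁺)
open import Data.Product using (Σ; ∃; _×_; _,_; proj₁; proj₂)
open import Data.Sum using (_⊎_; inj₁; inj₂)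
open import Function using (_∘_; _⇔_; mk⇔; Equivalence)
open import Relation.Binary using (DecidableEquality)
open import Relation.Binary.PropositionalEquality
  using (_≡_; _≢_; refl; sym; trans; cong; cong₂; subst; subst₂; module ≡-Reasoning)
open import Relation.Binary.Construct.Closure.ReflexiveTransitive using (ε; _◅_; _◅◅_; reverse; _⋆)
open import Relation.Nullary using (¬_; Dec; yes; no; does; contradiction; ¬?)
open import Relation.Nullary.Decidable using (_×-dec_; dec-true; dec-false; does-⇔)

-- Removing the head x from ys (by filtering) shortens ys strictly, since
-- x ∈ ys, and still contains the tail of the first list, since x ∉ xs.
module _ {A : Set} (_≟ᴬ_ : DecidableEquality A) where

  unique-⊆-length : ∀ {xs ys : List A} → Unique xs → xs ⊆ ys → length xs ≤ length ys
  unique-⊆-length {[]}     _              _     = z≤n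
  unique-⊆-length {x ∷ xs} {ys} (x∉xs ∷ xs!) xs⊆ys =
    ≤-trans (s≤s (unique-⊆-length xs! tail⊆)) (filter-notAll ≢x? ys x∈ys)
    where
    ≢x? = ¬? ∘ (_≟ᴬ x)
    tail⊆ : xs ⊆ filter ≢x? ys
    tail⊆ y∈xs = ∈-filter⁺ ≢x? (xs⊆ys (there y∈xs)) (λ y≡x → All.lookup x∉xs y∈xs (sym y≡x))
    x∈ys : Any (λ y → ¬ y ≢ x) ys
    x∈ys = Any.map (λ x≡y y≢x → y≢x (sym x≡y)) (xs⊆ys (here refl))

  avoid-two : ∀ {xs : List A} → Unique xs → 3 ≤ length xs →
              ∀ x y → ∃ λ z → z ∈ xs × z ≢ x × z ≢ y
  avoid-two {xs} xs! 3≤∣xs∣ x y with any? (λ z → ¬? (z ≟ᴬ x) ×-dec ¬? (z ≟ᴬ y)) xs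
  ... | yes found = let z , z∈xs , z≢x , z≢y = find found in z , z∈xs , z≢x , z≢y
  ... | no none   = contradiction (unique-⊆-length xs! xs⊆xy) (<⇒≱ 3≤∣xs∣)
    where
    xs⊆xy : xs ⊆ x ∷ y ∷ []
    xs⊆xy {z} z∈xs with z ≟ᴬ x | z ≟ᴬ y
    ... | yes z≡x | _       = here z≡x
    ... | no _    | yes z≡y = there (here z≡y)
    ... | no z≢x  | no z≢y  = contradiction (lose z∈xs (z≢x , z≢y)) none

module _ {n : ℕ} (G : Graph n) where

  Adj-sym : ∀ {u v} → Adj G u v → Adj G v u
  Adj-sym {u} {v} e = trans (Graph.sym G v u) e

  Adj-irrefl : ∀ {u v} → Adj G u v → u ≢ v
  Adj-irrefl {u} e refl with () ← trans (sym e) (irref G u)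

  connected-via : (z : Fin n) → (∀ v → Reachable G v z) → Connected G
  connected-via z reach u v = reach u ◅◅ reverse Adj-sym (reach v)

  reachable-closed : (S : Fin n → Set) → (∀ {x y} → Adj G x y → S x → S y) →
                     ∀ {x y} → Reachable G x y → S x → S y
  reachable-closed S closed ε        sx = sx
  reachable-closed S closed (e ◅ es) sx = reachable-closed S closed es (closed e sx)

  neighbours : Fin n → List (Fin n)
  neighbours v = filterᵇ (adj G v) (allFin n)

  neighbours-unique : ∀ v → Unique (neighbours v)
  neighbours-unique v = filter⁺ _ (allFin⁺ n)

  ∈-neighbours : ∀ {v w} → w ∈ neighbours v ⇔ Adj G v w
  ∈-neighbours {v} {w} = mk⇔
    (λ w∈ → Equivalence.to T-≡ (proj₂ (∈-filter⁻ _ {xs = allFin n} w∈)))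
    (λ e → ∈-filter⁺ _ (∈-allFin w) (Equivalence.from T-≡ e))

  -- Degree bounds via vertex labels (toℕ): v together with its neighbours
  -- carries degree + 1 distinct labels.
  closedLabels : Fin n → List ℕ
  closedLabels v = toℕ v ∷ map toℕ (neighbours v)

  closedLabels-unique : ∀ v → Unique (closedLabels v)
  closedLabels-unique v =
    All.tabulate v≢nbr ∷ map⁺ toℕ-injective (neighbours-unique v)
    where
    v≢nbr : ∀ {y} → y ∈ map toℕ (neighbours v) → toℕ v ≢ y
    v≢nbr y∈ with w , w∈ , refl ← ∈-map⁻ toℕ y∈ =
      Adj-irrefl (Equivalence.to ∈-neighbours w∈) ∘ toℕ-injective

  closedLabels-length : ∀ v → length (closedLabels v) ≡ suc (degree G v)
  closedLabels-length v = cong suc (length-map toℕ (neighbours v))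

  degree-lower : ∀ v {ls : List ℕ} → Unique ls →
                 (∀ {y} → y ∈ ls → y ≡ toℕ v ⊎ ∃ λ w → toℕ w ≡ y × Adj G v w) →
                 length ls ≤ suc (degree G v)
  degree-lower v ls! labels = ≤-trans
    (unique-⊆-length _≟ℕ_ ls! (λ y∈ → closed (labels y∈)))
    (≤-reflexive (closedLabels-length v))
    where
    closed : ∀ {y} → y ≡ toℕ v ⊎ (∃ λ w → toℕ w ≡ y × Adj G v w) → y ∈ closedLabels v
    closed (inj₁ refl)              = here refl
    closed (inj₂ (w , refl , v~w)) = there (∈-map⁺ toℕ (Equivalence.from ∈-neighbours v~w))

  degree-upper : ∀ v (ls : List ℕ) → toℕ v ∈ ls → (∀ {w} → Adj G v w → toℕ w ∈ ls) →
                 suc (degree G v) ≤ length ls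
  degree-upper v ls v∈ nbr∈ = ≤-trans
    (≤-reflexive (sym (closedLabels-length v)))
    (unique-⊆-length _≟ℕ_ (closedLabels-unique v) sub)
    where
    sub : closedLabels v ⊆ ls
    sub (here refl)  = v∈
    sub (there y∈) with w , w∈ , refl ← ∈-map⁻ toℕ y∈ = nbr∈ (Equivalence.to ∈-neighbours w∈)

module _ {n : ℕ} (G : Graph n) (a b : Fin n) where

  private
    H = deleteEdge G a b

    isEnd-self : isEnd a b a b ≡ true
    isEnd-self with a ≟ a | b ≟ b
    ... | yes _ | yes _     = refl
    ... | no a≢a | _        = contradiction refl a≢a
    ... | yes _  | no b≢b   = contradiction refl b≢b

    isEnd-other : ∀ {u v} → ¬ (u ≡ a × v ≡ b) → isEnd a b u v ≡ false
    isEnd-other {u} {v} ¬ab with u ≟ a | v ≟ b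
    ... | yes u≡a | yes v≡b = contradiction (u≡a , v≡b) ¬ab
    ... | yes _   | no _    = refl
    ... | no _    | _       = refl

  deleteEdge-⊆ : ∀ {u v} → Adj H u v → Adj G u v
  deleteEdge-⊆ {u} {v} e with adj G u v
  ... | true = refl

  deleteEdge-keeps : ∀ {u v} → ¬ (u ≡ a × v ≡ b) → ¬ (u ≡ b × v ≡ a) → Adj G u v → Adj H u v
  deleteEdge-keeps {u} {v} ¬ab ¬ba e
    rewrite e | isEnd-other ¬ab | isEnd-other {v} {u} (λ (v≡a , u≡b) → ¬ba (u≡b , v≡a)) = refl

  deleteEdge-removes : ¬ Adj H b a
  deleteEdge-removes e = contradiction (trans (sym e) lost) λ ()
    where
    lost : adj G b a ∧ not (isEnd a b b a) ∧ not (isEnd a b a b) ≡ false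
    lost rewrite isEnd-self | ∧-zeroʳ (not (isEnd a b b a)) = ∧-zeroʳ (adj G b a)

  separated⇒disconnected : (S : Fin n → Set) → (∀ {x y} → Adj H x y → S x → S y) →
                           S b → ¬ S a → ¬ Connected H
  separated⇒disconnected S closed sb ¬sa conn =
    ¬sa (reachable-closed H S closed (conn b a) sb)

  -- An edge {a,b} lying on a triangle a–w–b is not a cut edge of a connected
  -- graph: each use of {a,b} in a walk can be rerouted through w.
  triangle⇒connected : ∀ {w} → Adj G a w → Adj G w b → Connected G → Connected H
  triangle⇒connected {w} a~w w~b conn x y = (reroute ⋆) (conn x y)
    where
    w≢a : w ≢ a
    w≢a = Adj-irrefl G a~w ∘ sym
    w≢b : w ≢ b
    w≢b = Adj-irrefl G w~b

    to-w : ∀ {u} → Adj G u w → Adj H u w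
    to-w = deleteEdge-keeps (w≢b ∘ proj₂) (w≢a ∘ proj₂)

    from-w : ∀ {u} → Adj G w u → Adj H w u
    from-w = Adj-sym H ∘ to-w ∘ Adj-sym G

    reroute : ∀ {u v} → Adj G u v → Reachable H u v
    reroute {u} {v} e with (u ≟ a) ×-dec (v ≟ b) | (u ≟ b) ×-dec (v ≟ a)
    ... | yes (refl , refl) | _                 = to-w a~w ◅ from-w w~b ◅ ε
    ... | no _              | yes (refl , refl) = to-w (Adj-sym G w~b) ◅ from-w (Adj-sym G a~w) ◅ ε
    ... | no ¬ab            | no ¬ba            = deleteEdge-keeps ¬ab ¬ba e ◅ ε

pred-square : ∀ k → k * k ∸ 1 ≡ (k ∸ 1) * k + (k ∸ 1)
pred-square zero    = refl
pred-square (suc j) = +-comm j (j * suc j)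

minDegree-identity : ∀ k → 2 ≤ k → (k ∸ 1) * k ≡ (k * k ∸ 1) ∸ k + 1
minDegree-identity k@(suc (suc i)) (s≤s (s≤s z≤n)) = sym (begin
    (k * k ∸ 1) ∸ k + 1           ≡⟨ cong (λ t → t ∸ k + 1) (pred-square k) ⟩
    (suc Q + suc i) ∸ k + 1       ≡⟨ cong (_+ 1) (m+n∸n≡m Q (suc i)) ⟩
    Q + 1                         ≡⟨ +-comm Q 1 ⟩
    suc Q                         ∎)
  where
  open ≡-Reasoning
  Q = suc i + i * k

-- The graph R on n = k² - 1 vertices, for k ≥ 3.  Vertex labels 0 … n-1:
--   * 0 is the hub;
--   * 1 … k-1 are the roots; root b is the b-th block's link to the hub;
--   * a label x ≥ k belongs to block x / k.
-- Block b (1 ≤ b < k) consists of the root b and the labels b·k … b·k + k - 1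
-- below n, so it has k + 1 vertices, except block k - 1 which has k.
module Construction (k : ℕ) (3≤k : 3 ≤ k) where

  0<k : 0 < k
  0<k = ≤-trans (s≤s z≤n) 3≤k

  instance
    k-nonZero : NonZero k
    k-nonZero = >-nonZero 0<k

  N : ℕ
  N = k * k ∸ 1

  1≤k∸1 : 1 ≤ k ∸ 1
  1≤k∸1 = ∸-monoˡ-≤ 1 (≤-trans (s≤s (s≤s z≤n)) 3≤k)

  suc[k∸1]≡k : suc (k ∸ 1) ≡ k
  suc[k∸1]≡k = m+[n∸m]≡n 0<k

  k≤b*k : ∀ {b} → 1 ≤ b → k ≤ b * k
  k≤b*k 1≤b = ≤-trans (≤-reflexive (sym (*-identityˡ k))) (*-monoˡ-≤ k 1≤b)

  k≤N : k ≤ N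
  k≤N = ≤-trans (k≤b*k 1≤k∸1) (≤-trans (m≤m+n _ (k ∸ 1)) (≤-reflexive (sym (pred-square k))))

  member<N : ∀ {b j} → b < k → j < k ∸ 1 → b * k + j < N
  member<N b<k j<k∸1 = ≤-trans (+-mono-≤-< (*-monoˡ-≤ k (∸-monoˡ-≤ 1 b<k)) j<k∸1)
                               (≤-reflexive (sym (pred-square k)))

  block : ℕ → ℕ
  block x with x <? k
  ... | yes _ = x
  ... | no  _ = x / k

  block-root : ∀ {x} → x < k → block x ≡ x
  block-root {x} x<k with x <? k
  ... | yes _   = refl
  ... | no  x≮k = contradiction x<k x≮k

  block-large : ∀ {x} → k ≤ x → block x ≡ x / k
  block-large {x} k≤x with x <? k
  ... | yes x<k = contradiction k≤x (<⇒≱ x<k)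
  ... | no  _   = refl

  block-member : ∀ {b j} → 1 ≤ b → j < k → block (b * k + j) ≡ b
  block-member {b} {j} 1≤b j<k = begin
    block (b * k + j)    ≡⟨ block-large (≤-trans (k≤b*k 1≤b) (m≤m+n _ j)) ⟩
    (b * k + j) / k      ≡⟨ +-distrib-/-∣ˡ j (divides-refl b) ⟩
    b * k / k + j / k    ≡⟨ cong₂ _+_ (m*n/n≡m b k) (m<n⇒m/n≡0 j<k) ⟩
    b + 0                ≡⟨ +-identityʳ b ⟩
    b                    ∎
    where open ≡-Reasoning

  block-range : ∀ {x} → 1 ≤ x → x < N → 1 ≤ block x × block x < k
  block-range {x} 1≤x x<N with x <? k
  ... | yes x<k = 1≤x , x<k
  ... | no  x≮k = m≥n⇒m/n>0 (≮⇒≥ x≮k) , m<n*o⇒m/o<n (≤-trans x<N (m∸n≤m (k * k) 1))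

  Link : ℕ → ℕ → Set
  Link zero    zero    = ⊥
  Link zero    (suc y) = suc y < k
  Link (suc x) zero    = suc x < k
  Link (suc x) (suc y) = suc x ≢ suc y × block (suc x) ≡ block (suc y)

  link? : ∀ x y → Dec (Link x y)
  link? zero    zero    = no λ ()
  link? zero    (suc y) = suc y <? k
  link? (suc x) zero    = suc x <? k
  link? (suc x) (suc y) = ¬? (suc x ≟ℕ suc y) ×-dec (block (suc x) ≟ℕ block (suc y))

  Link-sym : ∀ {x y} → Link x y → Link y x
  Link-sym {zero}  {suc y} l               = l
  Link-sym {suc x} {zero}  l               = l
  Link-sym {suc x} {suc y} (x≢y , same) = x≢y ∘ sym , sym same

  Link-irrefl : ∀ x → ¬ Link x x
  Link-irrefl zero    ()
  Link-irrefl (suc x) (x≢x , _) = x≢x refl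

  hub-link : ∀ {y} → 1 ≤ y → y < k → Link 0 y
  hub-link {suc y} _ y<k = y<k

  hub-link⁻ : ∀ {y} → Link 0 y → 1 ≤ y × y < k
  hub-link⁻ {suc y} y<k = s≤s z≤n , y<k

  block-link : ∀ {x y} → 1 ≤ x → 1 ≤ y → x ≢ y → block x ≡ block y → Link x y
  block-link {suc x} {suc y} _ _ x≢y same = x≢y , same

  block-link⁻ : ∀ {x y} → 1 ≤ x → 1 ≤ y → Link x y → block x ≡ block y
  block-link⁻ {suc x} {suc y} _ _ (_ , same) = same

  R : Graph N
  R = record
    { adj   = λ u v → does (link? (toℕ u) (toℕ v))
    ; sym   = λ u v → does-⇔ (mk⇔ Link-sym Link-sym) (link? (toℕ u) (toℕ v)) (link? (toℕ v) (toℕ u))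
    ; irref = λ v → dec-false (link? (toℕ v) (toℕ v)) (Link-irrefl (toℕ v))
    }

  Adj⇒Link : ∀ {u v} → Adj R u v → Link (toℕ u) (toℕ v)
  Adj⇒Link {u} {v} e with link? (toℕ u) (toℕ v)
  ... | yes l = l
  Adj⇒Link {u} {v} () | no _

  Link⇒Adj : ∀ {u v} → Link (toℕ u) (toℕ v) → Adj R u v
  Link⇒Adj {u} {v} = dec-true (link? (toℕ u) (toℕ v))

  vertex : ∀ {y} → y < N → Fin N
  vertex y<N = fromℕ< y<N

  hub : Fin N
  hub = vertex (≤-trans 0<k k≤N)

  toℕ-hub : toℕ hub ≡ 0
  toℕ-hub = toℕ-fromℕ< _

  labelled-neighbour : ∀ v {y} → y < N → Link (toℕ v) y → ∃ λ w → toℕ w ≡ y × Adj R v w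
  labelled-neighbour v y<N l =
    vertex y<N , toℕ-fromℕ< y<N , Link⇒Adj (subst (Link (toℕ v)) (sym (toℕ-fromℕ< y<N)) l)

  -- The labels of block b that are present in every block: its root and
  -- b·k … b·k + k - 2.  There are k of them.
  members : ℕ → List ℕ
  members b = b ∷ applyUpTo (λ j → b * k + j) (k ∸ 1)

  members-length : ∀ b → length (members b) ≡ k
  members-length b = trans (cong suc (length-applyUpTo _ (k ∸ 1))) suc[k∸1]≡k

  members-unique : ∀ {b} → 1 ≤ b → b < k → Unique (members b)
  members-unique {b} 1≤b b<k = All.tabulate root≢ ∷ applyUpTo⁺₁ _ (k ∸ 1) offsets≢
    where
    root≢ : ∀ {y} → y ∈ applyUpTo (λ j → b * k + j) (k ∸ 1) → b ≢ y
    root≢ y∈ with j , _ , refl ← ∈-applyUpTo⁻ _ y∈ =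
      <⇒≢ (≤-trans b<k (≤-trans (k≤b*k 1≤b) (m≤m+n _ j)))
    offsets≢ : ∀ {i j} → i < j → j < k ∸ 1 → b * k + i ≢ b * k + j
    offsets≢ i<j _ = <⇒≢ i<j ∘ +-cancelˡ-≡ (b * k) _ _

  ∈-members : ∀ {b y} → 1 ≤ b → b < k → y ∈ members b → 1 ≤ y × y < N × block y ≡ b
  ∈-members 1≤b b<k (here refl) = 1≤b , ≤-trans b<k k≤N , block-root b<k
  ∈-members {b} 1≤b b<k (there y∈) with j , j<k∸1 , refl ← ∈-applyUpTo⁻ _ y∈ =
    ≤-trans 0<k (≤-trans (k≤b*k 1≤b) (m≤m+n _ j)) ,
    member<N b<k j<k∸1 ,
    block-member 1≤b (≤-trans j<k∸1 (m∸n≤m k 1))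

  hub-neighbour : ∀ {w} → Adj R hub w → 1 ≤ toℕ w × toℕ w < k
  hub-neighbour {w} hub~w = hub-link⁻ (subst (λ x → Link x (toℕ w)) toℕ-hub (Adj⇒Link hub~w))

  hub-or-not : ∀ (v : Fin N) → toℕ v ≡ 0 ⊎ 1 ≤ toℕ v
  hub-or-not v with toℕ v
  ... | zero  = inj₁ refl
  ... | suc _ = inj₂ (s≤s z≤n)

  closed-hub-≥ : ∀ v → toℕ v ≡ 0 → k ≤ suc (degree R v)
  closed-hub-≥ v v≡0 = subst (_≤ suc (degree R v)) (length-upTo k) (degree-lower R v (upTo⁺ k) labels)
    where
    labels : ∀ {y} → y ∈ upTo k → y ≡ toℕ v ⊎ ∃ λ w → toℕ w ≡ y × Adj R v w
    labels {zero}  _  = inj₁ (sym v≡0)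
    labels {suc y} y∈ = inj₂ (labelled-neighbour v (≤-trans (∈-upTo⁻ y∈) k≤N)
                          (subst (λ x → Link x (suc y)) (sym v≡0) (hub-link (s≤s z≤n) (∈-upTo⁻ y∈))))

  closed-block-≥ : ∀ v → 1 ≤ toℕ v → k ≤ suc (degree R v)
  closed-block-≥ v 1≤x = subst (_≤ suc (degree R v)) (members-length b)
                           (degree-lower R v (members-unique 1≤b b<k) labels)
    where
    b = block (toℕ v)
    1≤b = proj₁ (block-range 1≤x (toℕ<n v))
    b<k = proj₂ (block-range 1≤x (toℕ<n v))
    labels : ∀ {y} → y ∈ members b → y ≡ toℕ v ⊎ ∃ λ w → toℕ w ≡ y × Adj R v w
    labels {y} y∈ with y ≟ℕ toℕ v
    ... | yes y≡x = inj₁ y≡x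
    ... | no  y≢x = let 1≤y , y<N , same = ∈-members 1≤b b<k y∈ in
      inj₂ (labelled-neighbour v y<N (block-link 1≤x 1≤y (y≢x ∘ sym) (sym same)))

  degree-≥ : ∀ v → k ∸ 1 ≤ degree R v
  degree-≥ v = ≤-pred (subst (_≤ suc (degree R v)) (sym suc[k∸1]≡k) closed)
    where
    closed : k ≤ suc (degree R v)
    closed with hub-or-not v
    ... | inj₁ v≡0 = closed-hub-≥ v v≡0
    ... | inj₂ 1≤x = closed-block-≥ v 1≤x

  hub-degree : degree R hub ≡ k ∸ 1
  hub-degree = cong pred (trans (≤-antisym upper (closed-hub-≥ hub toℕ-hub)) (sym suc[k∸1]≡k))
    where
    upper : suc (degree R hub) ≤ k
    upper = subst (suc (degree R hub) ≤_) (length-upTo k)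
              (degree-upper R hub (upTo k) (∈-upTo⁺ (subst (_< k) (sym toℕ-hub) 0<k))
                (∈-upTo⁺ ∘ proj₂ ∘ hub-neighbour))

  root-to-hub : ∀ {v} → 1 ≤ toℕ v → toℕ v < k → Adj R v hub
  root-to-hub {v} 1≤x x<k = Link⇒Adj (subst (Link (toℕ v)) (sym toℕ-hub) (Link-sym (hub-link 1≤x x<k)))

  to-root : ∀ v → 1 ≤ toℕ v → k ≤ toℕ v → ∃ λ ρ → Adj R v ρ × 1 ≤ toℕ ρ × toℕ ρ < k
  to-root v 1≤x k≤x = let ρ , ρ≡b , v~ρ = labelled-neighbour v (≤-trans b<k k≤N) v-b in
    ρ , v~ρ , subst (1 ≤_) (sym ρ≡b) 1≤b , subst (_< k) (sym ρ≡b) b<k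
    where
    1≤b = proj₁ (block-range 1≤x (toℕ<n v))
    b<k = proj₂ (block-range 1≤x (toℕ<n v))
    v-b : Link (toℕ v) (block (toℕ v))
    v-b = block-link 1≤x 1≤b (λ x≡b → <⇒≱ b<k (subst (k ≤_) x≡b k≤x)) (sym (block-root b<k))

  to-hub : ∀ v → Reachable R v hub
  to-hub v with hub-or-not v
  ... | inj₁ v≡0 = subst (λ u → Reachable R u hub) (toℕ-injective (trans toℕ-hub (sym v≡0))) ε
  ... | inj₂ 1≤x with toℕ v <? k
  ...   | yes x<k = root-to-hub 1≤x x<k ◅ ε
  ...   | no  x≮k with ρ , v~ρ , 1≤ρ , ρ<k ← to-root v 1≤x (≮⇒≥ x≮k) = v~ρ ◅ root-to-hub 1≤ρ ρ<k ◅ ε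

  R-connected : Connected R
  R-connected = connected-via R hub to-hub

  -- Each hub–root edge is a cut edge: without it, the root's block is
  -- closed under adjacency but does not contain the hub.
  hub-edge-cut : ∀ {r} → Adj R hub r → ¬ Connected (deleteEdge R hub r)
  hub-edge-cut {r} hub~r =
    separated⇒disconnected R hub r InBlock closed (proj₁ (hub-neighbour hub~r) , refl) hub∉
    where
    InBlock : Fin N → Set
    InBlock w = 1 ≤ toℕ w × block (toℕ w) ≡ block (toℕ r)

    hub∉ : ¬ InBlock hub
    hub∉ (1≤hub , _) with () ← subst (1 ≤_) toℕ-hub 1≤hub

    closed : ∀ {x y} → Adj (deleteEdge R hub r) x y → InBlock x → InBlock y
    closed {x} {y} e (1≤x , same) with hub-or-not y
    ... | inj₂ 1≤y = 1≤y , trans (sym (block-link⁻ 1≤x 1≤y (Adj⇒Link (deleteEdge-⊆ R hub r {x} {y} e)))) same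
    ... | inj₁ y≡0 = contradiction (subst₂ (Adj (deleteEdge R hub r)) x≡r y≡hub e) (deleteEdge-removes R hub r)
      where
      x<k : toℕ x < k
      x<k = proj₂ (hub-link⁻ (Link-sym (subst (Link (toℕ x)) y≡0 (Adj⇒Link (deleteEdge-⊆ R hub r {x} {y} e)))))
      x≡r : x ≡ r
      x≡r = toℕ-injective (begin
        toℕ x            ≡⟨ sym (block-root x<k) ⟩
        block (toℕ x)    ≡⟨ same ⟩
        block (toℕ r)    ≡⟨ block-root (proj₂ (hub-neighbour hub~r)) ⟩
        toℕ r            ∎)
        where open ≡-Reasoning
      y≡hub : y ≡ hub
      y≡hub = toℕ-injective (trans y≡0 (sym toℕ-hub))

  -- No other edge is a cut edge: it joins two vertices of one block, and a
  -- third vertex of that block closes a triangle.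
  block-edge-not-cut : ∀ {u v} → 1 ≤ toℕ u → 1 ≤ toℕ v → Adj R u v → Connected (deleteEdge R u v)
  block-edge-not-cut {u} {v} 1≤x 1≤y u~v =
    let z , z∈ , z≢x , z≢y = third
        1≤z , z<N , z-in-b = ∈-members 1≤b b<k z∈
        w , w≡z , u~w = labelled-neighbour u z<N (block-link 1≤x 1≤z (z≢x ∘ sym) (sym z-in-b))
        w-v = block-link 1≤z 1≤y z≢y (trans z-in-b same)
    in triangle⇒connected R u v u~w (Link⇒Adj (subst (λ t → Link t (toℕ v)) (sym w≡z) w-v)) R-connected
    where
    b = block (toℕ u)
    1≤b = proj₁ (block-range 1≤x (toℕ<n u))
    b<k = proj₂ (block-range 1≤x (toℕ<n u))
    same : block (toℕ u) ≡ block (toℕ v)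
    same = block-link⁻ 1≤x 1≤y (Adj⇒Link u~v)
    third : ∃ λ z → z ∈ members b × z ≢ toℕ u × z ≢ toℕ v
    third = avoid-two _≟ℕ_ (members-unique 1≤b b<k)
              (subst (3 ≤_) (sym (members-length b)) 3≤k) (toℕ u) (toℕ v)

  R-cutEdges : NumCutEdges R (k ∸ 1)
  R-cutEdges = hubEdges , map⁺ (cong proj₂) (neighbours-unique R hub) ,
               trans (length-map hubEdge (neighbours R hub)) hub-degree ,
               λ u v → mk⇔ sound complete
    where
    hubEdge : Fin N → Fin N × Fin N
    hubEdge w = hub , w

    hubEdges : List (Fin N × Fin N)
    hubEdges = map hubEdge (neighbours R hub)

    sound : ∀ {u v} → (u , v) ∈ hubEdges → u <ᶠ v × IsCutEdge R u v
    sound uv∈ with w , w∈ , refl ← ∈-map⁻ hubEdge uv∈ =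
      let hub~w = Equivalence.to (∈-neighbours R {hub} {w}) w∈ in
      subst (_< toℕ w) (sym toℕ-hub) (proj₁ (hub-neighbour hub~w)) , hub~w , hub-edge-cut hub~w

    complete : ∀ {u v} → u <ᶠ v × IsCutEdge R u v → (u , v) ∈ hubEdges
    complete {u} {v} (u<v , u~v , cut) with hub-or-not u
    ... | inj₂ 1≤x = contradiction (block-edge-not-cut 1≤x (≤-trans 1≤x (<⇒≤ u<v)) u~v) cut
    ... | inj₁ u≡0 with refl ← toℕ-injective (trans u≡0 (sym toℕ-hub)) =
      ∈-map⁺ hubEdge (Equivalence.from (∈-neighbours R {hub} {v}) u~v)

theorem3p3 : (k : ℕ) → 3 ≤ k →
    Σ (Graph (k * k ∸ 1)) λ R →
    Connected R ×
    (Σ ℕ λ δ → MinDegree R δ × δ * k ≡ (k * k ∸ 1) ∸ k + 1) ×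
    NumCutEdges R (k ∸ 1)
-- R_n is connected, has minimum degree δ = k - 1 (attained at the hub), and
-- its cut edges are exactly the k - 1 hub–root edges.
theorem3p3 k 3≤k =
  R , R-connected ,
  (k ∸ 1 , (degree-≥ , hub , hub-degree) , minDegree-identity k (<⇒≤ 3≤k)) ,
  R-cutEdges
  where open Construction k 3≤k
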